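{- For every Greene–Kleitman chain $C$ of length $h\ge 5$ in $Q_n$ and any edge $f$ of $C$, there exist $h-1$ pairwise edge-disjoint 4-cycles, one flipping 4-cycle between $C$ and each of the $h-1$ children of $C$, none of which contains the edge $f$.
   Context: $Q_n$: vertices are bitstrings of length $n$, adjacent if they differ in one bit. $D$ is the set of bitstrings (including the empty string) with equally many 0s and 1s such that every prefix has at least as many 0s as 1s. A Greene–Kleitman chain is a string $C=u_0*u_1*\cdots*u_h$ of length $n$ over $\{0,1,*\}$ with $u_0,\ldots,u_h\in D$; its length is $h$, and it represents the path in $Q_n$ with vertices obtained by replacing the $*$s by $i$ ones followed by $h-i$ zeros, $i=0,\ldots,h$. A child of $C$ is a chain obtained from $C$ by replacing two consecutive $*$s (the $j$-th and $(j+1)$-st, $1\le j\le h-1$) by $0$ and $1$ respectively; $C$ has exactly $h-1$ children. A flipping 4-cycle between two vertex-disjoint paths $P,P'$ is a 4-cycle of $Q_n$ that shares exactly one edge with each of $P$ and $P'$. -}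

module Defs where

open import Data.Bool using (Bool; true; false)
open import Data.Nat using (ℕ; zero; suc; _≤_; _<_; _∸_)
open import Data.Fin using (Fin; toℕ)
open import Data.List using (List; []; _∷_; _++_; map; length)
open import Data.List.Relation.Unary.All using (All)
open import Data.Vec using (Vec; []; _∷_; lookup; toList)
open import Data.Product using (Σ; ∃; _×_; _,_)
open import Data.Sum using (_⊎_)
open import Relation.Binary.PropositionalEquality using (_≡_; _≢_)
open import Relation.Nullary using (¬_)

-- Bitstrings and the Dyck set D  (false = 0, true = 1)

count0 : List Bool → ℕ
count0 []           = 0
count0 (false ∷ w)  = suc (count0 w)
count0 (true ∷ w)   = count0 w

count1 : List Bool → ℕ
count1 []           = 0
count1 (false ∷ w)  = count1 w
count1 (true ∷ w)   = suc (count1 w)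

InD : List Bool → Set
InD w = (count0 w ≡ count1 w) × (∀ p q → p ++ q ≡ w → count1 p ≤ count0 p)

data Sym : Set where
  o one star : Sym

bit : Bool → Sym
bit false = o
bit true  = one

assemble : List Bool → List (List Bool) → List Sym
assemble u₀ []         = map bit u₀
assemble u₀ (u₁ ∷ us)  = map bit u₀ ++ (star ∷ assemble u₁ us)

IsGK : ∀ {n} → Vec Sym n → ℕ → Set
IsGK C h = Σ (List Bool) λ u₀ → Σ (List (List Bool)) λ us →
  (length us ≡ h) × All InD (u₀ ∷ us) × (toList C ≡ assemble u₀ us)

fill : ∀ {m} → ℕ → Vec Sym m → Vec Bool m
fill i []               = []
fill i (o ∷ c)          = false ∷ fill i c
fill i (one ∷ c)        = true ∷ fill i c
fill zero (star ∷ c)    = false ∷ fill zero c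
fill (suc i) (star ∷ c) = true ∷ fill i c

-- child: replace the (k+1)-st and (k+2)-nd *s (0-indexed k, k+1) by 0 and 1
replNext : ∀ {m} → Vec Sym m → Vec Sym m
replNext []           = []
replNext (star ∷ c)   = one ∷ c
replNext (x ∷ c)      = x ∷ replNext c

child : ∀ {m} → ℕ → Vec Sym m → Vec Sym m
child k []                 = []
child zero (star ∷ c)      = o ∷ replNext c
child (suc k) (star ∷ c)   = star ∷ child k c
child k (x ∷ c)            = x ∷ child k c

Adj : ∀ {n} → Vec Bool n → Vec Bool n → Set
Adj {n} x y = Σ (Fin n) λ k → (lookup x k ≢ lookup y k) ×
  (∀ j → j ≢ k → lookup x j ≡ lookup y j)

-- (unordered) edges, represented by their two endpoints
Edge : ℕ → Set
Edge n = Vec Bool n × Vec Bool n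

SameEdge : ∀ {n} → Edge n → Edge n → Set
SameEdge (a , b) (c , d) = ((a ≡ c) × (b ≡ d)) ⊎ ((a ≡ d) × (b ≡ c))

PathEdge : ∀ {n} → Vec Sym n → ℕ → Edge n → Set
PathEdge C h e = Σ ℕ λ i → (i < h) × SameEdge e (fill i C , fill (suc i) C)

record Cycle4 (n : ℕ) : Set where
  field
    v₀ v₁ v₂ v₃ : Vec Bool n
    a₀₁ : Adj v₀ v₁
    a₁₂ : Adj v₁ v₂
    a₂₃ : Adj v₂ v₃
    a₃₀ : Adj v₃ v₀
    d₀₂ : v₀ ≢ v₂
    d₁₃ : v₁ ≢ v₃

cycEdge : ∀ {n} → Cycle4 n → Fin 4 → Edge n
cycEdge c Fin.zero                          = Cycle4.v₀ c , Cycle4.v₁ c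
cycEdge c (Fin.suc Fin.zero)                = Cycle4.v₁ c , Cycle4.v₂ c
cycEdge c (Fin.suc (Fin.suc Fin.zero))      = Cycle4.v₂ c , Cycle4.v₃ c
cycEdge c (Fin.suc (Fin.suc (Fin.suc Fin.zero))) = Cycle4.v₃ c , Cycle4.v₀ c

ContainsEdge : ∀ {n} → Cycle4 n → Edge n → Set
ContainsEdge c e = ∃ λ (t : Fin 4) → SameEdge (cycEdge c t) e

SharesExactlyOne : ∀ {n} → Cycle4 n → Vec Sym n → ℕ → Set
SharesExactlyOne c P h = Σ (Fin 4) λ t → PathEdge P h (cycEdge c t) ×
  (∀ t' → t' ≢ t → ¬ PathEdge P h (cycEdge c t'))

Flipping : ∀ {n} → Cycle4 n → Vec Sym n → ℕ → Vec Sym n → ℕ → Set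
Flipping c P h P' h' = SharesExactlyOne c P h × SharesExactlyOne c P' h'

EdgeDisjoint : ∀ {n} → Cycle4 n → Cycle4 n → Set
EdgeDisjoint c d = ∀ t t' → ¬ SameEdge (cycEdge c t) (cycEdge d t')

-- Index the path of C by P_a (the first a stars set to 1) and that of its k-th child by
-- Q^k_b (the pattern of P_b with 0, 1 inserted at stars k, k+1).  For a star i ∉ {k, k+1},
-- the edge P_i P_{i+1} and the child edge flipping the same star i span a flipping 4-cycle
-- whose two other edges flip star k or k+1.  Cycles of different children using different
-- stars i are edge-disjoint: edges within C or within a child are told apart by the star they
-- flip, and an edge between C and child k determines k.  So it suffices to choose, injectively
-- in k, a star i ∉ {k, k+1} other than the star flipped by f: rotate k by -2 modulo h - 1,
-- which moves every k by at least 2 once h ≥ 5, and then skip that star.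
module Submission where

open import Defs
open import Data.Nat using (ℕ; _≤_; _∸_)
open import Data.Fin using (Fin; toℕ)
open import Data.Vec using (Vec)
open import Data.Product using (Σ; _×_)
open import Relation.Binary.PropositionalEquality using (_≢_)
open import Relation.Nullary using (¬_)

open import Data.Bool using (Bool; true; false)
open import Data.Nat using (zero; suc; _+_; _<_; z≤n; s≤s; _≟_)
open import Data.Nat.Properties
  using (suc-injective; <⇒≤; ≤-refl; ≤-trans; ≤-reflexive; <-≤-trans; m≤n⇒m≤1+n; n≤1+n)
open import Data.Fin using (fromℕ; fromℕ<; inject₁; punchIn)
open import Data.Fin.Patterns using (0F; 1F; 2F; 3F)
open import Data.Fin.Properties
  using (toℕ-injective; toℕ<n; toℕ-fromℕ; toℕ-fromℕ<; toℕ-inject₁; fromℕ≢inject₁;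
         inject₁-injective; punchIn-injective; punchInᵢ≢i)
open import Data.Vec using ([]; _∷_; toList)
open import Data.Vec.Properties using (∷-injectiveˡ; ∷-injectiveʳ)
open import Data.List using (List; []; _∷_; _++_; map; length)
open import Data.Product using (∃; _,_; proj₁; proj₂)
open import Data.Sum using (_⊎_; inj₁; inj₂)
open import Data.Empty using (⊥-elim)
open import Function using (_∘_; const)
open import Relation.Binary.PropositionalEquality
  using (_≡_; refl; sym; trans; cong; cong₂; subst; subst₂; module ≡-Reasoning)
open import Relation.Nullary using (contradiction)
open import Relation.Nullary.Decidable using (decidable-stable)

cons : Bool → (ℕ → Bool) → ℕ → Bool
cons b g zero    = b
cons b g (suc t) = g t

prefixOnes : ℕ → ℕ → Bool
prefixOnes zero    = const false
prefixOnes (suc i) = cons true (prefixOnes i)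

insert01 : ℕ → (ℕ → Bool) → ℕ → Bool
insert01 zero    g = cons false (cons true g)
insert01 (suc k) g = cons (g zero) (insert01 k (g ∘ suc))

fillBy : ∀ {m} → (ℕ → Bool) → Vec Sym m → Vec Bool m
fillBy g []         = []
fillBy g (o ∷ c)    = false ∷ fillBy g c
fillBy g (one ∷ c)  = true ∷ fillBy g c
fillBy g (star ∷ c) = g zero ∷ fillBy (g ∘ suc) c

starCount : List Sym → ℕ
starCount []         = zero
starCount (star ∷ w) = suc (starCount w)
starCount (_ ∷ w)    = starCount w

stars : ∀ {m} → Vec Sym m → ℕ
stars c = starCount (toList c)

fill-fillBy : ∀ {m} i (c : Vec Sym m) → fill i c ≡ fillBy (prefixOnes i) c
fill-fillBy i       []         = refl
fill-fillBy i       (o ∷ c)    = cong (false ∷_) (fill-fillBy i c)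
fill-fillBy i       (one ∷ c)  = cong (true ∷_) (fill-fillBy i c)
fill-fillBy zero    (star ∷ c) = cong (false ∷_) (fill-fillBy zero c)
fill-fillBy (suc i) (star ∷ c) = cong (true ∷_) (fill-fillBy i c)

fillBy-replNext : ∀ {m} g (c : Vec Sym m) → fillBy g (replNext c) ≡ fillBy (cons true g) c
fillBy-replNext g []         = refl
fillBy-replNext g (o ∷ c)    = cong (false ∷_) (fillBy-replNext g c)
fillBy-replNext g (one ∷ c)  = cong (true ∷_) (fillBy-replNext g c)
fillBy-replNext g (star ∷ c) = refl

fillBy-child : ∀ {m} k g (c : Vec Sym m) → fillBy g (child k c) ≡ fillBy (insert01 k g) c
fillBy-child zero    g []         = refl
fillBy-child (suc k) g []         = refl
fillBy-child zero    g (o ∷ c)    = cong (false ∷_) (fillBy-child zero g c)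
fillBy-child (suc k) g (o ∷ c)    = cong (false ∷_) (fillBy-child (suc k) g c)
fillBy-child zero    g (one ∷ c)  = cong (true ∷_) (fillBy-child zero g c)
fillBy-child (suc k) g (one ∷ c)  = cong (true ∷_) (fillBy-child (suc k) g c)
fillBy-child zero    g (star ∷ c) = cong (false ∷_) (fillBy-replNext g c)
fillBy-child (suc k) g (star ∷ c) = cong (g zero ∷_) (fillBy-child k (g ∘ suc) c)

fillBy-cong : ∀ {m} (c : Vec Sym m) {g g'} → (∀ t → g t ≡ g' t) → fillBy g c ≡ fillBy g' c
fillBy-cong []         e = refl
fillBy-cong (o ∷ c)    e = cong (false ∷_) (fillBy-cong c e)
fillBy-cong (one ∷ c)  e = cong (true ∷_) (fillBy-cong c e)
fillBy-cong (star ∷ c) e = cong₂ _∷_ (e zero) (fillBy-cong c (e ∘ suc))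

fillBy-agree : ∀ {m} (c : Vec Sym m) {g g' t} →
               fillBy g c ≡ fillBy g' c → t < stars c → g t ≡ g' t
fillBy-agree (o ∷ c)    e t<s = fillBy-agree c (∷-injectiveʳ e) t<s
fillBy-agree (one ∷ c)  e t<s = fillBy-agree c (∷-injectiveʳ e) t<s
fillBy-agree (star ∷ c) {t = zero}  e _         = ∷-injectiveˡ e
fillBy-agree (star ∷ c) {t = suc t} e (s≤s t<s) = fillBy-agree c (∷-injectiveʳ e) t<s

record DifferOnlyAt (g g' : ℕ → Bool) (t : ℕ) : Set where
  field
    differ : g t ≢ g' t
    agree  : ∀ s → s ≢ t → g s ≡ g' s
open DifferOnlyAt

DifferOnlyAt-sym : ∀ {g g' t} → DifferOnlyAt g g' t → DifferOnlyAt g' g t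
DifferOnlyAt-sym D = record { differ = differ D ∘ sym ; agree = λ s s≢t → sym (agree D s s≢t) }

DifferOnlyAt-zero : ∀ {g g'} → g zero ≢ g' zero → (∀ s → g (suc s) ≡ g' (suc s)) →
                    DifferOnlyAt g g' zero
DifferOnlyAt-zero ne eq = record
  { differ = ne ; agree = λ { zero 0≢0 → contradiction refl 0≢0 ; (suc s) _ → eq s } }

DifferOnlyAt-suc : ∀ {g g' t} → g zero ≡ g' zero → DifferOnlyAt (g ∘ suc) (g' ∘ suc) t →
                   DifferOnlyAt g g' (suc t)
DifferOnlyAt-suc e D = record
  { differ = differ D ; agree = λ { zero _ → e ; (suc s) s≢t → agree D s (s≢t ∘ cong suc) } }

DifferOnlyAt-tail : ∀ {g g' t} → DifferOnlyAt g g' (suc t) → DifferOnlyAt (g ∘ suc) (g' ∘ suc) t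
DifferOnlyAt-tail D = record
  { differ = differ D ; agree = λ s s≢t → agree D (suc s) (s≢t ∘ suc-injective) }

Adj-∷ : ∀ {n b} {x y : Vec Bool n} → Adj x y → Adj (b ∷ x) (b ∷ y)
Adj-∷ (k , ne , eq) = Fin.suc k , ne , λ
  { Fin.zero _ → refl ; (Fin.suc j) j≢k → eq j (j≢k ∘ cong Fin.suc) }

Adj-head : ∀ {n b b'} {x : Vec Bool n} → b ≢ b' → Adj (b ∷ x) (b' ∷ x)
Adj-head ne = Fin.zero , ne , λ
  { Fin.zero 0≢0 → contradiction refl 0≢0 ; (Fin.suc j) _ → refl }

Adj-fillBy : ∀ {m} (c : Vec Sym m) {g g' t} →
             DifferOnlyAt g g' t → t < stars c → Adj (fillBy g c) (fillBy g' c)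
Adj-fillBy (o ∷ c)   D t<s = Adj-∷ (Adj-fillBy c D t<s)
Adj-fillBy (one ∷ c) D t<s = Adj-∷ (Adj-fillBy c D t<s)
Adj-fillBy (star ∷ c) {t = zero} D _
  rewrite fillBy-cong c (λ s → agree D (suc s) λ ()) = Adj-head (differ D)
Adj-fillBy (star ∷ c) {t = suc t} D (s≤s t<s)
  rewrite agree D zero (λ ()) = Adj-∷ (Adj-fillBy c (DifferOnlyAt-tail D) t<s)

flipped-star-unique : ∀ {m} (c : Vec Sym m) {g₁ g₁' g₂ g₂' d₁ d₂} →
  DifferOnlyAt g₁ g₁' d₁ → DifferOnlyAt g₂ g₂' d₂ → d₁ < stars c →
  fillBy g₁ c ≡ fillBy g₂ c → fillBy g₁' c ≡ fillBy g₂' c → d₁ ≡ d₂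
flipped-star-unique c {g₁} {g₁'} {g₂} {g₂'} {d₁} {d₂} D₁ D₂ d₁<s e e' =
  decidable-stable (d₁ ≟ d₂) λ d₁≢d₂ → differ D₁ (begin
    g₁ d₁   ≡⟨ fillBy-agree c e d₁<s ⟩
    g₂ d₁   ≡⟨ agree D₂ d₁ d₁≢d₂ ⟩
    g₂' d₁  ≡⟨ fillBy-agree c e' d₁<s ⟨
    g₁' d₁  ∎)
  where open ≡-Reasoning

prefixOnes-< : ∀ {i t} → t < i → prefixOnes i t ≡ true
prefixOnes-< {suc i} {zero}  _         = refl
prefixOnes-< {suc i} {suc t} (s≤s t<i) = prefixOnes-< t<i

prefixOnes-≥ : ∀ {i t} → i ≤ t → prefixOnes i t ≡ false
prefixOnes-≥ z≤n       = refl
prefixOnes-≥ (s≤s i≤t) = prefixOnes-≥ i≤t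

prefixOnes-antitone : ∀ i t → prefixOnes i (suc t) ≡ true → prefixOnes i t ≡ true
prefixOnes-antitone (suc i) zero    _ = refl
prefixOnes-antitone (suc i) (suc t) e = prefixOnes-antitone i t e

prefixOnes-flip : ∀ i → DifferOnlyAt (prefixOnes i) (prefixOnes (suc i)) i
prefixOnes-flip zero    = DifferOnlyAt-zero (λ ()) (λ _ → refl)
prefixOnes-flip (suc i) = DifferOnlyAt-suc refl (prefixOnes-flip i)

insert01-at : ∀ k g → insert01 k g k ≡ false
insert01-at zero    g = refl
insert01-at (suc k) g = insert01-at k (g ∘ suc)

insert01-at-suc : ∀ k g → insert01 k g (suc k) ≡ true
insert01-at-suc zero    g = refl
insert01-at-suc (suc k) g = insert01-at-suc k (g ∘ suc)

-- A chain vertex is monotone along the stars, a child-k vertex reads 0 then 1 at stars k, k+1.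
chain-not-child : ∀ {m} (c : Vec Sym m) a k g → suc k < stars c →
                  fillBy (prefixOnes a) c ≢ fillBy (insert01 k g) c
chain-not-child c a k g k<s e = contradiction (begin
    false              ≡⟨ insert01-at k g ⟨
    insert01 k g k     ≡⟨ fillBy-agree c e (<⇒≤ k<s) ⟨
    prefixOnes a k     ≡⟨ prefixOnes-antitone a k (begin
      prefixOnes a (suc k)       ≡⟨ fillBy-agree c e k<s ⟩
      insert01 k g (suc k)       ≡⟨ insert01-at-suc k g ⟩
      true                       ∎) ⟩
    true               ∎) λ ()
  where open ≡-Reasoning

-- Rung k a b: the edge P_a Q^k_b of a flipping cycle of child k.
data Rung (k : ℕ) : ℕ → ℕ → Set where
  before : ∀ {a} → a ≤ k → Rung k a a
  after  : ∀ {j} → k ≤ j → Rung k (suc (suc j)) j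

rungStar : ∀ {k a b} → Rung k a b → ℕ
rungStar {k} (before _) = suc k
rungStar {k} (after _)  = k

Rung-flip : ∀ {k a b} (r : Rung k a b) →
            DifferOnlyAt (prefixOnes a) (insert01 k (prefixOnes b)) (rungStar r)
Rung-flip {zero}  (before z≤n)     =
  DifferOnlyAt-suc refl (DifferOnlyAt-zero (λ ()) (λ _ → refl))
Rung-flip {suc k} (before z≤n)     = DifferOnlyAt-suc refl (Rung-flip {k} (before z≤n))
Rung-flip         (before (s≤s p)) = DifferOnlyAt-suc refl (Rung-flip (before p))
Rung-flip         (after z≤n)      = DifferOnlyAt-zero (λ ()) (λ _ → refl)
Rung-flip         (after (s≤s p))  = DifferOnlyAt-suc refl (Rung-flip (after p))

rungStar<h : ∀ {h k a b} (r : Rung k a b) → suc k < h → rungStar r < h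
rungStar<h (before _) k<h = k<h
rungStar<h (after _)  k<h = <⇒≤ k<h

rungSide : ∀ {k a b} → Rung k a b → Bool
rungSide (before _) = false
rungSide (after _)  = true

Rung-chainBit : ∀ {k a b} (r : Rung k a b) → prefixOnes a (rungStar r) ≡ rungSide r
Rung-chainBit (before a≤k) = prefixOnes-≥ (m≤n⇒m≤1+n a≤k)
Rung-chainBit (after k≤j)  = prefixOnes-< (m≤n⇒m≤1+n (s≤s k≤j))

Rung-index-unique : ∀ {k k' a a' b b'} (r : Rung k a b) (r' : Rung k' a' b') →
                    rungStar r ≡ rungStar r' → rungSide r ≡ rungSide r' → k ≡ k'
Rung-index-unique (before _) (before _) e _ = suc-injective e
Rung-index-unique (after _)  (after _)  e _ = e
Rung-index-unique (before _) (after _)  _ ()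
Rung-index-unique (after _)  (before _) _ ()

-- Admissible k i j: the child edge Q^k_{j+1} Q^k_j flips star i, like P_i P_{i+1}.
data Admissible (k : ℕ) : ℕ → ℕ → Set where
  before : ∀ {i} → i < k → Admissible k i i
  after  : ∀ {j} → k ≤ j → Admissible k (suc (suc j)) j

admissible : ∀ {k i} → 2 + k ≤ i ⊎ i < k → ∃ (Admissible k i)
admissible (inj₁ (s≤s (s≤s k≤j))) = _ , after k≤j
admissible (inj₂ i<k)             = _ , before i<k

Admissible-rungs : ∀ {k i j} → Admissible k i j → Rung k i j × Rung k (suc i) (suc j)
Admissible-rungs (before i<k) = before (<⇒≤ i<k) , before i<k
Admissible-rungs (after k≤j)  = after k≤j , after (m≤n⇒m≤1+n k≤j)

Admissible-flip : ∀ {k i j} → Admissible k i j →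
  DifferOnlyAt (insert01 k (prefixOnes (suc j))) (insert01 k (prefixOnes j)) i
Admissible-flip {suc k} (before {zero} _)        = DifferOnlyAt-zero (λ ()) (λ _ → refl)
Admissible-flip {suc k} (before {suc i} (s≤s p)) =
  DifferOnlyAt-suc refl (Admissible-flip (before p))
Admissible-flip         (after {j} z≤n)          =
  DifferOnlyAt-suc refl (DifferOnlyAt-suc refl (DifferOnlyAt-sym (prefixOnes-flip j)))
Admissible-flip         (after (s≤s p))          = DifferOnlyAt-suc refl (Admissible-flip (after p))

Admissible-partner< : ∀ {h k i j} → Admissible k i j → suc k < h → i < h → j < h ∸ 2
Admissible-partner< (before i<k) (s≤s (s≤s k≤h)) _                 = <-≤-trans i<k k≤h
Admissible-partner< (after _)    _               (s≤s (s≤s j<h)) = j<h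

SameEdge-refl : ∀ {n} {e : Edge n} → SameEdge e e
SameEdge-refl = inj₁ (refl , refl)

SameEdge-sym : ∀ {n} {e e' : Edge n} → SameEdge e e' → SameEdge e' e
SameEdge-sym (inj₁ (refl , refl)) = inj₁ (refl , refl)
SameEdge-sym (inj₂ (refl , refl)) = inj₂ (refl , refl)

SameEdge-trans : ∀ {n} {e e' e'' : Edge n} → SameEdge e e' → SameEdge e' e'' → SameEdge e e''
SameEdge-trans (inj₁ (refl , refl)) s                    = s
SameEdge-trans (inj₂ (refl , refl)) (inj₁ (refl , refl)) = inj₂ (refl , refl)
SameEdge-trans (inj₂ (refl , refl)) (inj₂ (refl , refl)) = inj₁ (refl , refl)

SameEdge-both : ∀ {n} (P : Vec Bool n → Set) {e e' : Edge n} → SameEdge e e' →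
                P (proj₁ e') → P (proj₂ e') → P (proj₁ e) × P (proj₂ e)
SameEdge-both P (inj₁ (refl , refl)) p q = p , q
SameEdge-both P (inj₂ (refl , refl)) p q = q , p

suc-toℕ< : ∀ {h} (k : Fin (h ∸ 1)) → suc (toℕ k) < h
suc-toℕ< {suc h} k = s≤s (toℕ<n k)

module FlippingCycles {n} (C : Vec Sym n) (h : ℕ) (stars≡h : stars C ≡ h) where

  <stars : ∀ {t} → t < h → t < stars C
  <stars = subst (_ <_) (sym stars≡h)

  P : ℕ → Vec Bool n
  P a = fillBy (prefixOnes a) C

  Q : ℕ → ℕ → Vec Bool n
  Q k b = fillBy (insert01 k (prefixOnes b)) C

  OnChain : Vec Bool n → Set
  OnChain x = ∃ λ a → x ≡ P a

  off-chain : ∀ {k g} → suc k < h → ¬ OnChain (fillBy (insert01 k g) C)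
  off-chain k<h (a , e) = chain-not-child C a _ _ (<stars k<h) (sym e)

  Pure : Edge n → Set
  Pure (x , y) = (OnChain x × OnChain y) ⊎ (¬ OnChain x × ¬ OnChain y)

  record Straight (d : ℕ) (e : Edge n) : Set where
    field
      {from to} : ℕ → Bool
      flips     : DifferOnlyAt from to d
      star<h    : d < h
      pure      : Pure e
      edge      : SameEdge e (fillBy from C , fillBy to C)

  record RungEdge (k : ℕ) (e : Edge n) : Set where
    field
      {a b}   : ℕ
      rung    : Rung k a b
      child<h : suc k < h
      edge    : SameEdge e (P a , Q k b)

  straight-star-unique : ∀ {d d' e e'} → Straight d e → Straight d' e' → SameEdge e e' → d ≡ d'
  straight-star-unique S S' s
    with SameEdge-trans (SameEdge-sym (Straight.edge S)) (SameEdge-trans s (Straight.edge S'))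
  ... | inj₁ (e₁ , e₂) = flipped-star-unique C (Straight.flips S) (Straight.flips S')
                           (<stars (Straight.star<h S)) e₁ e₂
  ... | inj₂ (e₁ , e₂) = flipped-star-unique C (Straight.flips S)
                           (DifferOnlyAt-sym (Straight.flips S')) (<stars (Straight.star<h S)) e₁ e₂

  straight-not-rung : ∀ {d k e e'} → Straight d e → RungEdge k e' → ¬ SameEdge e e'
  straight-not-rung {e = _ , _} S R s
    with SameEdge-trans s (RungEdge.edge R) | Straight.pure S
  ... | inj₁ (refl , refl) | inj₁ (_ , on-y)  = off-chain (RungEdge.child<h R) on-y
  ... | inj₁ (refl , refl) | inj₂ (off-x , _) = off-x (RungEdge.a R , refl)
  ... | inj₂ (refl , refl) | inj₁ (on-x , _)  = off-chain (RungEdge.child<h R) on-x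
  ... | inj₂ (refl , refl) | inj₂ (_ , off-y) = off-y (RungEdge.a R , refl)

  rung-child-unique : ∀ {k k' e e'} → RungEdge k e → RungEdge k' e' → SameEdge e e' → k ≡ k'
  rung-child-unique R R' s
    with SameEdge-trans (SameEdge-sym (RungEdge.edge R)) (SameEdge-trans s (RungEdge.edge R'))
  ... | inj₂ (e₁ , _)  = ⊥-elim (off-chain (RungEdge.child<h R') (RungEdge.a R , sym e₁))
  ... | inj₁ (e₁ , e₂) = Rung-index-unique r r' same-star same-side
    where
      r = RungEdge.rung R
      r' = RungEdge.rung R'
      star< = <stars (rungStar<h r (RungEdge.child<h R))
      same-star = flipped-star-unique C (Rung-flip r) (Rung-flip r') star< e₁ e₂
      same-side = trans (sym (Rung-chainBit r)) (trans (fillBy-agree C e₁ star<)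
                    (trans (cong (prefixOnes (RungEdge.a R')) same-star) (Rung-chainBit r')))

  shapes-disjoint : ∀ {i i' k k' e e'} → i ≢ i' → k ≢ k' →
    Straight i e ⊎ RungEdge k e → Straight i' e' ⊎ RungEdge k' e' → ¬ SameEdge e e'
  shapes-disjoint i≢i' _ (inj₁ S) (inj₁ S') s = i≢i' (straight-star-unique S S' s)
  shapes-disjoint _    _ (inj₁ S) (inj₂ R') s = straight-not-rung S R' s
  shapes-disjoint _    _ (inj₂ R) (inj₁ S') s = straight-not-rung S' R (SameEdge-sym s)
  shapes-disjoint _ k≢k' (inj₂ R) (inj₂ R') s = k≢k' (rung-child-unique R R' s)

  pathEdge-chain : ∀ {e} → (pe : PathEdge C h e) → SameEdge e (P (proj₁ pe) , P (suc (proj₁ pe)))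
  pathEdge-chain {e} (m , _ , s) =
    subst₂ (λ x y → SameEdge e (x , y)) (fill-fillBy m C) (fill-fillBy (suc m) C) s

  pathEdge-onChain : ∀ {e} → PathEdge C h e → OnChain (proj₁ e) × OnChain (proj₂ e)
  pathEdge-onChain pe@(m , _) = SameEdge-both OnChain (pathEdge-chain pe) (m , refl) (suc m , refl)

  pathEdge-straight : ∀ {e} → (pe : PathEdge C h e) → Straight (proj₁ pe) e
  pathEdge-straight pe@(m , m<h , _) = record
    { flips = prefixOnes-flip m ; star<h = m<h
    ; pure = inj₁ (pathEdge-onChain pe) ; edge = pathEdge-chain pe }

  child-fill : ∀ k b → fill b (child k C) ≡ Q k b
  child-fill k b = trans (fill-fillBy b (child k C)) (fillBy-child k (prefixOnes b) C)

  childPathEdge-offChain : ∀ {k h' e} → suc k < h → PathEdge (child k C) h' e →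
                           ¬ OnChain (proj₁ e) × ¬ OnChain (proj₂ e)
  childPathEdge-offChain {k} {e = e} k<h (j , _ , s) =
    SameEdge-both (¬_ ∘ OnChain) s' (off-chain k<h) (off-chain k<h)
    where s' = subst₂ (λ x y → SameEdge e (x , y)) (child-fill k j) (child-fill k (suc j)) s

  module _ {k i j} (adm : Admissible k i j) (k<h : suc k < h) (i<h : i < h) where

    private
      r₀ = proj₁ (Admissible-rungs adm)
      r₁ = proj₂ (Admissible-rungs adm)

    cycle : Cycle4 n
    cycle = record
      { v₀ = P i ; v₁ = P (suc i) ; v₂ = Q k (suc j) ; v₃ = Q k j
      ; a₀₁ = Adj-fillBy C (prefixOnes-flip i) (<stars i<h)
      ; a₁₂ = Adj-fillBy C (Rung-flip r₁) (<stars (rungStar<h r₁ k<h))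
      ; a₂₃ = Adj-fillBy C (Admissible-flip adm) (<stars i<h)
      ; a₃₀ = Adj-fillBy C (DifferOnlyAt-sym (Rung-flip r₀)) (<stars (rungStar<h r₀ k<h))
      ; d₀₂ = chain-not-child C i k _ (<stars k<h)
      ; d₁₃ = chain-not-child C (suc i) k _ (<stars k<h)
      }

    cycle-edge : ∀ t → Straight i (cycEdge cycle t) ⊎ RungEdge k (cycEdge cycle t)
    cycle-edge 0F = inj₁ record
      { flips = prefixOnes-flip i ; star<h = i<h
      ; pure = inj₁ ((i , refl) , (suc i , refl)) ; edge = SameEdge-refl }
    cycle-edge 1F = inj₂ record
      { rung = r₁ ; child<h = k<h ; edge = SameEdge-refl }
    cycle-edge 2F = inj₁ record
      { flips = Admissible-flip adm ; star<h = i<h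
      ; pure = inj₂ (off-chain k<h , off-chain k<h) ; edge = SameEdge-refl }
    cycle-edge 3F = inj₂ record
      { rung = r₀ ; child<h = k<h ; edge = inj₂ (refl , refl) }

    cycle-flipping : Flipping cycle C h (child k C) (h ∸ 2)
    cycle-flipping = (0F , on-C , not-on-C) , (2F , on-child , not-on-child)
      where
        on-C : PathEdge C h (P i , P (suc i))
        on-C = i , i<h , SameEdge-sym (pathEdge-chain (i , i<h , SameEdge-refl))

        on-child : PathEdge (child k C) (h ∸ 2) (Q k (suc j) , Q k j)
        on-child = j , Admissible-partner< adm k<h i<h
                     , inj₂ (sym (child-fill k (suc j)) , sym (child-fill k j))

        not-on-C : ∀ t → t ≢ 0F → ¬ PathEdge C h (cycEdge cycle t)
        not-on-C 0F 0≢0 _  = 0≢0 refl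
        not-on-C 1F _   pe = off-chain k<h (proj₂ (pathEdge-onChain pe))
        not-on-C 2F _   pe = off-chain k<h (proj₁ (pathEdge-onChain pe))
        not-on-C 3F _   pe = off-chain k<h (proj₁ (pathEdge-onChain pe))

        not-on-child : ∀ t → t ≢ 2F → ¬ PathEdge (child k C) (h ∸ 2) (cycEdge cycle t)
        not-on-child 0F _   pe = proj₁ (childPathEdge-offChain k<h pe) (i , refl)
        not-on-child 1F _   pe = proj₁ (childPathEdge-offChain k<h pe) (suc i , refl)
        not-on-child 2F 2≢2 _  = 2≢2 refl
        not-on-child 3F _   pe = proj₂ (childPathEdge-offChain k<h pe) (i , refl)

    cycle-avoids : ∀ {f} (pe : PathEdge C h f) → i ≢ proj₁ pe → ¬ ContainsEdge cycle f
    cycle-avoids pe i≢m (t , s) with cycle-edge t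
    ... | inj₁ S = i≢m (straight-star-unique S (pathEdge-straight pe) s)
    ... | inj₂ R = straight-not-rung (pathEdge-straight pe) R (SameEdge-sym s)

  cycles-disjoint : ∀ {k i j k' i' j'} (adm : Admissible k i j) k<h i<h
                    (adm' : Admissible k' i' j') k'<h i'<h →
                    k ≢ k' → i ≢ i' → EdgeDisjoint (cycle adm k<h i<h) (cycle adm' k'<h i'<h)
  cycles-disjoint adm k<h i<h adm' k'<h i'<h k≢k' i≢i' t t' =
    shapes-disjoint i≢i' k≢k' (cycle-edge adm k<h i<h t) (cycle-edge adm' k'<h i'<h t')

  flipping-family : ∀ {f} (pe : PathEdge C h f) (slot : Fin (h ∸ 1) → ℕ) →
    (∀ k → slot k < h) → (∀ k → 2 + toℕ k ≤ slot k ⊎ slot k < toℕ k) →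
    (∀ k k' → slot k ≡ slot k' → k ≡ k') → (∀ k → slot k ≢ proj₁ pe) →
    Σ (Fin (h ∸ 1) → Cycle4 n) λ cyc →
      (∀ k → Flipping (cyc k) C h (child (toℕ k) C) (h ∸ 2) × ¬ ContainsEdge (cyc k) f)
      × (∀ k k' → k ≢ k' → EdgeDisjoint (cyc k) (cyc k'))
  flipping-family pe slot slot<h slot-far slot-injective slot≢m =
      cyc
    , (λ k → cycle-flipping (adm k) (suc-toℕ< k) (slot<h k)
           , cycle-avoids (adm k) (suc-toℕ< k) (slot<h k) pe (slot≢m k))
    , λ k k' k≢k' → cycles-disjoint (adm k) (suc-toℕ< k) (slot<h k) (adm k') (suc-toℕ< k') (slot<h k')
                      (k≢k' ∘ toℕ-injective) (k≢k' ∘ slot-injective k k')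
    where
      adm : ∀ k → Admissible (toℕ k) (slot k) _
      adm k = proj₂ (admissible (slot-far k))

      cyc : Fin (h ∸ 1) → Cycle4 n
      cyc k = cycle (adm k) (suc-toℕ< k) (slot<h k)

rotate₂ : ∀ {L} → Fin (suc (suc L)) → Fin (suc (suc L))
rotate₂ {L} 0F                    = inject₁ (fromℕ L)
rotate₂ {L} 1F                    = fromℕ (suc L)
rotate₂     (Fin.suc (Fin.suc k)) = inject₁ (inject₁ k)

rotate₂-injective : ∀ {L} {k k' : Fin (suc (suc L))} → rotate₂ k ≡ rotate₂ k' → k ≡ k'
rotate₂-injective {k = 0F}                  {0F}                  _ = refl
rotate₂-injective {k = 1F}                  {1F}                  _ = refl
rotate₂-injective {k = Fin.suc (Fin.suc _)} {Fin.suc (Fin.suc _)} e =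
  cong (Fin.suc ∘ Fin.suc) (inject₁-injective (inject₁-injective e))
rotate₂-injective {k = 0F}                  {1F}                  e = contradiction (sym e) fromℕ≢inject₁
rotate₂-injective {k = 1F}                  {0F}                  e = contradiction e fromℕ≢inject₁
rotate₂-injective {k = 1F}                  {Fin.suc (Fin.suc _)} e = contradiction e fromℕ≢inject₁
rotate₂-injective {k = Fin.suc (Fin.suc _)} {1F}                  e = contradiction (sym e) fromℕ≢inject₁
rotate₂-injective {k = 0F}                  {Fin.suc (Fin.suc _)} e =
  contradiction (inject₁-injective e) fromℕ≢inject₁
rotate₂-injective {k = Fin.suc (Fin.suc _)} {0F}                  e =
  contradiction (sym (inject₁-injective e)) fromℕ≢inject₁

rotate₂-far : ∀ {L} → 2 ≤ L → (k : Fin (suc (suc L))) →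
              2 + toℕ k ≤ toℕ (rotate₂ k) ⊎ 2 + toℕ (rotate₂ k) ≤ toℕ k
rotate₂-far {L} L≥2 0F =
  inj₁ (subst (2 ≤_) (sym (trans (toℕ-inject₁ (fromℕ L)) (toℕ-fromℕ L))) L≥2)
rotate₂-far {L} L≥2 1F = inj₁ (subst (3 ≤_) (sym (toℕ-fromℕ (suc L))) (s≤s L≥2))
rotate₂-far     _   (Fin.suc (Fin.suc k)) =
  inj₂ (s≤s (s≤s (≤-reflexive (trans (toℕ-inject₁ (inject₁ k)) (toℕ-inject₁ k)))))

toℕ-punchIn-≥ : ∀ {L} (i : Fin (suc L)) j → toℕ j ≤ toℕ (punchIn i j)
toℕ-punchIn-≥ 0F          j           = n≤1+n (toℕ j)
toℕ-punchIn-≥ (Fin.suc i) 0F          = z≤n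
toℕ-punchIn-≥ (Fin.suc i) (Fin.suc j) = s≤s (toℕ-punchIn-≥ i j)

toℕ-punchIn-≤ : ∀ {L} (i : Fin (suc L)) j → toℕ (punchIn i j) ≤ suc (toℕ j)
toℕ-punchIn-≤ 0F          j           = ≤-refl
toℕ-punchIn-≤ (Fin.suc i) 0F          = z≤n
toℕ-punchIn-≤ (Fin.suc i) (Fin.suc j) = s≤s (toℕ-punchIn-≤ i j)

slot : ∀ {L} → Fin (suc (suc (suc L))) → Fin (suc (suc L)) → Fin (suc (suc (suc L)))
slot m k = punchIn m (rotate₂ k)

slot-far : ∀ {L} → 2 ≤ L → ∀ m (k : Fin (suc (suc L))) →
           2 + toℕ k ≤ toℕ (slot m k) ⊎ toℕ (slot m k) < toℕ k
slot-far L≥2 m k with rotate₂-far L≥2 k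
... | inj₁ k+2≤r = inj₁ (≤-trans k+2≤r (toℕ-punchIn-≥ m (rotate₂ k)))
... | inj₂ r+2≤k = inj₂ (≤-trans (s≤s (toℕ-punchIn-≤ m (rotate₂ k))) r+2≤k)

starCount-++ : ∀ w w' → starCount (w ++ w') ≡ starCount w + starCount w'
starCount-++ []         w' = refl
starCount-++ (o ∷ w)    w' = starCount-++ w w'
starCount-++ (one ∷ w)  w' = starCount-++ w w'
starCount-++ (star ∷ w) w' = cong suc (starCount-++ w w')

starCount-bits : ∀ u → starCount (map bit u) ≡ 0
starCount-bits []          = refl
starCount-bits (false ∷ u) = starCount-bits u
starCount-bits (true ∷ u)  = starCount-bits u

starCount-assemble : ∀ u us → starCount (assemble u us) ≡ length us
starCount-assemble u []         = starCount-bits u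
starCount-assemble u (u₁ ∷ us) = begin
  starCount (map bit u ++ star ∷ assemble u₁ us)
    ≡⟨ starCount-++ (map bit u) _ ⟩
  starCount (map bit u) + suc (starCount (assemble u₁ us))
    ≡⟨ cong₂ (λ x y → x + suc y) (starCount-bits u) (starCount-assemble u₁ us) ⟩
  suc (length us)
    ∎
  where open ≡-Reasoning

IsGK-stars : ∀ {n} {C : Vec Sym n} {h} → IsGK C h → stars C ≡ h
IsGK-stars (u₀ , us , len , _ , C≡) = trans (cong starCount C≡) (trans (starCount-assemble u₀ us) len)

lemma13 : (n h : ℕ) (C : Vec Sym n) → IsGK C h → 5 ≤ h →
    (f : Edge n) → PathEdge C h f →
    Σ (Fin (h ∸ 1) → Cycle4 n) λ cyc →
      (∀ k → Flipping (cyc k) C h (child (toℕ k) C) (h ∸ 2) × ¬ ContainsEdge (cyc k) f)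
      × (∀ k k' → k ≢ k' → EdgeDisjoint (cyc k) (cyc k'))
lemma13 n .(suc (suc (suc L))) C gk (s≤s (s≤s (s≤s {n = L} L≥2))) f pe@(_ , m<h , _) =
  FlippingCycles.flipping-family C _ (IsGK-stars gk) pe (toℕ ∘ slot m)
    (toℕ<n ∘ slot m) (slot-far L≥2 m) slot-injective slot≢m
  where
    m = fromℕ< m<h

    slot-injective : ∀ k k' → toℕ (slot m k) ≡ toℕ (slot m k') → k ≡ k'
    slot-injective k k' e = rotate₂-injective (punchIn-injective m _ _ (toℕ-injective e))

    slot≢m : ∀ k → toℕ (slot m k) ≢ proj₁ pe
    slot≢m k e = punchInᵢ≢i m (rotate₂ k) (toℕ-injective (trans e (sym (toℕ-fromℕ< m<h))))
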